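{- Let $\Gamma$ be a graph of order $n$ with maximum degree $\delta_1$, minimum degree $\delta_n$, and write $A(\Gamma;x)=x^n\sum_{k\in\mathcal{K}}A_k(\Gamma)x^k$. Then: (i) all real zeros of $A(\Gamma;x)$ are non-positive; (ii) $0$ is a zero of $A(\Gamma;x)$ of multiplicity $n-\delta_1\ge 1$; (iii) for every $k\in\mathcal{K}$, $\sum_{i=k}^{\delta_1}A_i(\Gamma)$ is the number of defensive $k$-alliances $S$ in $\Gamma$ whose induced subgraph $\langle S\rangle$ is connected; (iv) if $\Gamma$ has at least one edge and its degree sequence takes exactly $r$ distinct values $c_1,\dots,c_r$, then $A(\Gamma;x)$ has at least $r+1$ nonzero terms, and the monomials $x^{n-c_1},\dots,x^{n-c_r},x^{n+\delta_n}$ all appear in $A(\Gamma;x)$ with nonzero coefficient; (v) $A(\Gamma;x)$ is either an even or an odd function of $x$ if and only if the degrees of the vertices of $\Gamma$ are either all even or all odd.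
   Context: All graphs are finite and simple with at least one vertex. For $\Gamma=(V,E)$, a vertex $v$ and $X\subseteq V$, $\delta_X(v)$ is the number of neighbours of $v$ in $X$, $\bar S=V\setminus S$, and $\mathcal{K}=[-\delta_1,\delta_1]\cap\mathbb{Z}$. A nonempty $S\subseteq V$ is a defensive $k$-alliance if $\delta_S(v)\ge\delta_{\bar S}(v)+k$ for all $v\in S$; its exact index of alliance is $k_S=\max\{k\in\mathcal{K}: S \text{ is a defensive } k\text{ -alliance}\}$. The alliance polynomial is $A(\Gamma;x)=\sum_{S} x^{n+k_S}$, the sum over all nonempty $S\subseteq V$ with $\langle S\rangle$ connected; thus $A_k(\Gamma)$ is the number of such $S$ with $k_S=k$. -}

module Defs where

open import Level using (Level; _⊔_) renaming (suc to lsuc)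
open import Data.Bool using (Bool; true; false)
open import Data.Nat as ℕ using (ℕ; zero; suc; _⊓_)
open import Data.Nat.Divisibility using (_∣_)
open import Data.Integer as ℤ using (ℤ; +_; -_)
import Data.Integer.Properties as ℤP
open import Data.Fin using (Fin)
open import Data.Fin.Subset using (Subset; _∈_; _∩_; ∁; ∣_∣; Nonempty)
open import Data.Fin.Subset.Properties using (_∈?_; nonempty?)
import Data.Fin.Properties as FinP
open import Data.Vec using (Vec; []; _∷_; tabulate)
open import Data.List using (List; []; _∷_; map; _++_; length; filter; upTo; allFin; foldr)
open import Data.Nat.ListAction using (sum)
open import Data.List.Membership.Propositional renaming (_∈_ to _∈ₗ_)
open import Data.List.Membership.DecPropositional ℤP._≟_ using () renaming (_∈?_ to _∈ₗ?_)
open import Data.List.Relation.Unary.All as All using (All)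
import Data.Sum
open import Data.Product using (Σ; _×_; _,_; ∃)
open import Relation.Nullary using (Dec; yes; no; ¬_)
open import Relation.Nullary.Decidable using (_×-dec_; _→-dec_; map′)
open import Relation.Binary.PropositionalEquality using (_≡_)
open import Algebra.Bundles using (CommutativeRing)

record Graph (n : ℕ) : Set where
  field
    adj    : Fin n → Fin n → Bool
    sym    : ∀ u v → adj u v ≡ adj v u
    irrefl : ∀ v → adj v v ≡ false

module _ {n : ℕ} (G : Graph n) where
  open Graph G

  N : Fin n → Subset n
  N v = tabulate (adj v)

  δ[_] : Subset n → Fin n → ℕ
  δ[ X ] v = ∣ X ∩ N v ∣

  deg : Fin n → ℕ
  deg v = ∣ N v ∣

  δ₁ : ℕ
  δ₁ = foldr ℕ._⊔_ 0 (map deg (allFin n))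

  -- minimum degree δₙ (for n ≥ 1 this is the minimum of all degrees)
  δₙ : ℕ
  δₙ = foldr _⊓_ δ₁ (map deg (allFin n))

  HasEdge : Set
  HasEdge = Σ (Fin n) λ u → Σ (Fin n) λ v → adj u v ≡ true

  𝒦 : List ℤ
  𝒦 = map (λ j → (- (+ δ₁)) ℤ.+ (+ j)) (upTo (suc (δ₁ ℕ.+ δ₁)))

  data WalkIn (S : Subset n) : Fin n → Fin n → Set where
    stay : ∀ {u} → u ∈ S → WalkIn S u u
    step : ∀ {u w v} → u ∈ S → adj u w ≡ true → WalkIn S w v → WalkIn S u v

  Connected : Subset n → Set
  Connected S = ∀ u v → u ∈ S → v ∈ S → WalkIn S u v

  DefAlliance : Subset n → ℤ → Set
  DefAlliance S k = Nonempty S × (∀ v → v ∈ S → (+ δ[ ∁ S ] v) ℤ.+ k ℤ.≤ + δ[ S ] v)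

  defAlliance? : ∀ S k → Dec (DefAlliance S k)
  defAlliance? S k = nonempty? S ×-dec
    map′ (λ f v → f v) (λ f v → f v) (FinP.all? (λ v → v ∈? S →-dec ((+ δ[ ∁ S ] v) ℤ.+ k ℤ.≤? + δ[ S ] v)))

  ExactIndex : Subset n → ℤ → Set
  ExactIndex S k = k ∈ₗ 𝒦 × DefAlliance S k × (∀ k′ → k′ ∈ₗ 𝒦 → DefAlliance S k′ → k′ ℤ.≤ k)

  exactIndex? : ∀ S k → Dec (ExactIndex S k)
  exactIndex? S k = (k ∈ₗ? 𝒦) ×-dec defAlliance? S k ×-dec
    map′ (λ a k′ m → All.lookup a m) (λ f → All.tabulate (λ {k′} m → f k′ m))
      (All.all? (λ k′ → defAlliance? S k′ →-dec (k′ ℤ.≤? k)) 𝒦)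

subsets : (n : ℕ) → List (Subset n)
subsets zero    = [] ∷ []
subsets (suc n) = map (true ∷_) (subsets n) ++ map (false ∷_) (subsets n)

countSubsets : {n : ℕ} {P : Subset n → Set} → ((S : Subset n) → Dec (P S)) → ℕ
countSubsets {n} P? = length (filter P? (subsets n))

-- The alliance polynomial.  It is parametrised by a decision procedure
-- for connectivity of induced subgraphs (any two such procedures give
-- the same counts).

module _ {n : ℕ} (G : Graph n) (conn? : ∀ S → Dec (Connected G S)) where

  A : ℤ → ℕ
  A k = countSubsets (λ S → nonempty? S ×-dec conn? S ×-dec exactIndex? G S k)

  #ConnDefAlliances : ℤ → ℕ
  #ConnDefAlliances k = countSubsets (λ S → defAlliance? G S k ×-dec conn? S)

  -- coefficient of x^j in A(Γ;x) = Σ_S x^{n+k_S}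
  coeff : ℕ → ℕ
  coeff j = A ((+ j) ℤ.- (+ n))

  -- the exponents 0 … 2n (A(Γ;x) has degree n + δ₁ ≤ 2n)
  exps : List ℕ
  exps = upTo (suc (n ℕ.+ n))

  #terms : ℕ
  #terms = length (filter (λ j → Relation.Nullary.¬? (coeff j ℕ.≟ 0)) exps)
    where import Relation.Nullary

  -- Σ_{i=k}^{δ₁} A_i(Γ)   (for k ≤ δ₁)
  sumFrom : ℤ → ℕ
  sumFrom k = sum (map (λ j → A (k ℤ.+ (+ j))) (upTo (suc ℤ.∣ (+ δ₁ G) ℤ.- k ∣)))

-- Parity of a polynomial with coefficients a : ℕ → ℕ (as a formal
-- identity in ℤ[x]): the coefficient of x^j in p(-x) is (-1)^j a_j.

negOnePow : ℕ → ℤ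
negOnePow zero    = ℤ.+ 1
negOnePow (suc j) = - negOnePow j

EvenPoly : (ℕ → ℕ) → Set
EvenPoly a = ∀ j → negOnePow j ℤ.* (+ a j) ≡ + a j

OddPoly : (ℕ → ℕ) → Set
OddPoly a = ∀ j → negOnePow j ℤ.* (+ a j) ≡ - (+ a j)

-- Ordered commutative rings (ℝ is one), used to talk about real zeros.

record OrderedCommutativeRing (c ℓ r : Level) : Set (lsuc (c ⊔ ℓ ⊔ r)) where
  field
    commRing : CommutativeRing c ℓ
  open CommutativeRing commRing public
  field
    _<_       : Carrier → Carrier → Set r
    <-irrefl  : ∀ {x y} → x ≈ y → ¬ (x < y)
    <-trans   : ∀ {x y z} → x < y → y < z → x < z
    <-respˡ-≈ : ∀ {x y z} → x ≈ y → x < z → y < z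
    <-respʳ-≈ : ∀ {x y z} → x ≈ y → z < x → z < y
    <-tri     : ∀ x y → (x < y) Data.Sum.⊎ ((x ≈ y) Data.Sum.⊎ (y < x))
    0<1       : 0# < 1#
    +-mono-<  : ∀ {x y} z → x < y → (x + z) < (y + z)
    *-pos     : ∀ {x y} → 0# < x → 0# < y → 0# < (x * y)

  fromℕ : ℕ → Carrier
  fromℕ zero    = 0#
  fromℕ (suc m) = 1# + fromℕ m

  pow : Carrier → ℕ → Carrier
  pow x zero    = 1#
  pow x (suc m) = x * pow x m

  evalPoly : (ℕ → ℕ) → List ℕ → Carrier → Carrier
  evalPoly a js x = foldr (λ j acc → (fromℕ (a j) * pow x j) + acc) 0# js

module Submission where

-- With Δ = δ₁, every index in 𝒦 is k = -Δ + i with 0 ≤ i ≤ 2Δ, and the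
-- defensive alliance condition at v becomes the inequality of naturals
-- δ_S̄(v) + i ≤ δ_S(v) + Δ.  The exact index of S is then the largest such
-- i (IsIndex), and x^j occurs in A(Γ;x) iff some connected S has
-- j + Δ = n + i_S (Terms.Witness).  Explicit witnesses give the monomials
-- the proposition is about: a singleton {v} gives x^{n - deg v} (the lowest
-- term x^{n-Δ} when deg v = Δ), the component of a vertex of minimum degree
-- gives x^{n + δₙ}, and the component of a non-isolated vertex gives a term
-- above x^n.  At a vertex where the alliance inequality is tight,
-- j ≡ n + deg v (mod 2), which is the heart of (v).  Part (i) is positivity
-- of a nonzero polynomial with natural coefficients at x > 0, and (iii) is a
-- double count of the indicators [k_S = k'] over all subsets S.

open import Defs
open import Level using (0ℓ)
open import Data.Bool using (Bool; true; false)
open import Data.Nat as ℕ using (ℕ; zero; suc; _+_; _∸_; _≤_; _<_; z≤n; s≤s)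
import Data.Nat.Properties as ℕP
open import Data.Nat.Divisibility using (_∣_; ∣-refl; ∣m∣n⇒∣m+n; ∣m+n∣m⇒∣n; ∣⇒≤; divides)
open import Data.Integer as ℤ using (ℤ; +_; -_; +≤+)
import Data.Integer.Properties as ℤP
open import Data.Integer.Tactic.RingSolver using (solve-∀)
open import Data.Nat.Tactic.RingSolver using () renaming (solve-∀ to ℕ-solve-∀)
open import Data.List using (List; []; _∷_; [_]; map; filter; length; upTo; allFin; _++_)
open import Data.List.Properties using (upTo-∷ʳ; map-++; map-cong; foldr-forcesᵇ)
open import Data.Nat.ListAction using (sum)
open import Data.Nat.ListAction.Properties using (sum-++)
open import Data.List.Membership.Propositional using () renaming (_∈_ to _∈ₗ_)
open import Data.List.Relation.Unary.Any using (here; there; index)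
open import Relation.Unary using (Decidable)
open import Data.Fin using (Fin; fromℕ<)
import Data.Fin.Properties as FinP
open import Data.Fin.Subset using (Subset; _∈_; _∉_; _∩_; _∪_; ∁; ∣_∣; Nonempty; ⁅_⁆; _⊆_)
open import Data.Fin.Subset.Properties
open import Data.Vec using ([]; _∷_; tabulate)
import Data.Vec.Properties as VecP
open import Data.List.Membership.Propositional.Properties using (foldr-selective; ∈-map⁺; ∈-map⁻; ∈-++⁺ˡ; ∈-++⁺ʳ; ∈-upTo⁺; ∈-upTo⁻; ∈-allFin; ∈-filter⁺)
open import Data.List.Relation.Unary.Any.Properties using (lookup-index)
import Data.List.Relation.Unary.All as All
open import Data.List.Relation.Unary.All.Properties using (all-filter)
open import Data.List.Extrema.Nat using (argmax; argmax-all; f[xs]≤f[argmax])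
open import Relation.Binary.PropositionalEquality hiding ([_]; J)
open import Relation.Nullary using (Dec; yes; no; ¬_; ¬?)
open import Relation.Nullary.Decidable using (_×-dec_; _→-dec_; map′)
open import Data.Product using (_×_; _,_; Σ; proj₁; proj₂)
open import Data.Sum using (_⊎_; inj₁; inj₂)
open import Data.Empty using (⊥; ⊥-elim)
open import Function.Bundles using (_⇔_; mk⇔; Equivalence)
open import Function.Definitions using (Injective)
open import Function.Construct.Composition using (_⇔-∘_)
open import Function.Construct.Symmetry using (⇔-sym)

-- The indices k ∈ 𝒦 = [-Δ, Δ] are exactly shift Δ i for i ∈ [0, 2Δ];
-- working with i keeps every alliance inequality inside ℕ.
shift : ℕ → ℕ → ℤ
shift Δ i = - (+ Δ) ℤ.+ + i

add-sub-cancel : ∀ x z → x ℤ.+ z ℤ.- z ≡ x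
add-sub-cancel = solve-∀

translate-≤ : ∀ {x y a b} z → x ℤ.+ z ≡ + a → y ℤ.+ z ≡ + b → x ℤ.≤ y ⇔ a ≤ b
translate-≤ {x} {y} z ex ey = mk⇔
  (λ x≤y → ℤP.drop‿+≤+ (subst₂ ℤ._≤_ ex ey (ℤP.+-monoˡ-≤ z x≤y)))
  (λ a≤b → subst₂ ℤ._≤_ (add-sub-cancel x z) (add-sub-cancel y z)
             (ℤP.+-monoˡ-≤ (- z) (subst₂ ℤ._≤_ (sym ex) (sym ey) (+≤+ a≤b))))

translate-≡ : ∀ {x y a b} z → x ℤ.+ z ≡ + a → y ℤ.+ z ≡ + b → x ≡ y ⇔ a ≡ b
translate-≡ {x} {y} z ex ey = mk⇔
  (λ x≡y → ℤP.+-injective (trans (sym ex) (trans (cong (ℤ._+ z) x≡y) ey)))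
  (λ a≡b → trans (sym (add-sub-cancel x z))
             (trans (cong (ℤ._- z) (trans ex (trans (cong +_ a≡b) (sym ey)))) (add-sub-cancel y z)))

shift-norm : ∀ Δ i → shift Δ i ℤ.+ + Δ ≡ + i
shift-norm Δ i = solve (+ Δ) (+ i)
  where solve : ∀ d i → (- d ℤ.+ i) ℤ.+ d ≡ i
        solve = solve-∀

shift-norm-+ : ∀ a Δ i → (+ a ℤ.+ shift Δ i) ℤ.+ + Δ ≡ + (a + i)
shift-norm-+ a Δ i = trans (solve (+ a) (+ Δ) (+ i)) (sym (ℤP.pos-+ a i))
  where solve : ∀ a d i → (a ℤ.+ (- d ℤ.+ i)) ℤ.+ d ≡ a ℤ.+ i
        solve = solve-∀

minus-norm : ∀ j n Δ → (+ j ℤ.- + n) ℤ.+ (+ n ℤ.+ + Δ) ≡ + (j + Δ)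
minus-norm j n Δ = trans (solve (+ j) (+ n) (+ Δ)) (sym (ℤP.pos-+ j Δ))
  where solve : ∀ j n d → (j ℤ.- n) ℤ.+ (n ℤ.+ d) ≡ j ℤ.+ d
        solve = solve-∀

shift-norm-n : ∀ n Δ m → shift Δ m ℤ.+ (+ n ℤ.+ + Δ) ≡ + (n + m)
shift-norm-n n Δ m = trans (solve (+ n) (+ Δ) (+ m)) (sym (ℤP.pos-+ n m))
  where solve : ∀ n d m → (- d ℤ.+ m) ℤ.+ (n ℤ.+ d) ≡ n ℤ.+ m
        solve = solve-∀

shift-≤ : ∀ Δ i j → shift Δ i ℤ.≤ shift Δ j ⇔ i ≤ j
shift-≤ Δ i j = translate-≤ (+ Δ) (shift-norm Δ i) (shift-norm Δ j)

shift-injective : ∀ Δ i j → shift Δ i ≡ shift Δ j → i ≡ j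
shift-injective Δ i j = Equivalence.to (translate-≡ (+ Δ) (shift-norm Δ i) (shift-norm Δ j))

shift-alliance : ∀ a b Δ i → + a ℤ.+ shift Δ i ℤ.≤ + b ⇔ a + i ≤ b + Δ
shift-alliance a b Δ i = translate-≤ (+ Δ) (shift-norm-+ a Δ i) (ℤP.pos-+ b Δ)

shift-exponent : ∀ j n Δ m → (+ j ℤ.- + n ≡ shift Δ m) ⇔ (j + Δ ≡ n + m)
shift-exponent j n Δ m = translate-≡ (+ n ℤ.+ + Δ) (minus-norm j n Δ) (shift-norm-n n Δ m)

shift-+ : ∀ Δ i j → shift Δ i ℤ.+ + j ≡ shift Δ (i + j)
shift-+ Δ i j = trans (ℤP.+-assoc (- (+ Δ)) (+ i) (+ j)) (cong (λ w → - (+ Δ) ℤ.+ w) (sym (ℤP.pos-+ i j)))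

window-width : ∀ Δ i → i ≤ Δ + Δ → ℤ.∣ + Δ ℤ.- shift Δ i ∣ ≡ Δ + Δ ∸ i
window-width Δ i i≤ = cong ℤ.∣_∣ difference
  where
  solve : ∀ d i → (d ℤ.- (- d ℤ.+ i)) ℤ.+ i ≡ d ℤ.+ d
  solve = solve-∀
  difference : + Δ ℤ.- shift Δ i ≡ + (Δ + Δ ∸ i)
  difference = Equivalence.from
    (translate-≡ (+ i) (trans (solve (+ Δ) (+ i)) (sym (ℤP.pos-+ Δ Δ))) (sym (ℤP.pos-+ (Δ + Δ ∸ i) i)))
    (sym (ℕP.m∸n+n≡m i≤))

𝟙 : ∀ {p} {P : Set p} → Dec P → ℕ
𝟙 (yes _) = 1
𝟙 (no _)  = 0

𝟙-yes : ∀ {p} {P : Set p} → P → (P? : Dec P) → 𝟙 P? ≡ 1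
𝟙-yes p (yes _) = refl
𝟙-yes p (no ¬p) = ⊥-elim (¬p p)

𝟙-no : ∀ {p} {P : Set p} → ¬ P → (P? : Dec P) → 𝟙 P? ≡ 0
𝟙-no ¬p (yes p) = ⊥-elim (¬p p)
𝟙-no ¬p (no _)  = refl

𝟙-cong : ∀ {p q} {P : Set p} {Q : Set q} → (P → Q) → (Q → P) → (P? : Dec P) (Q? : Dec Q) → 𝟙 P? ≡ 𝟙 Q?
𝟙-cong f g (yes p) (yes q) = refl
𝟙-cong f g (yes p) (no ¬q) = ⊥-elim (¬q (f p))
𝟙-cong f g (no ¬p) (yes q) = ⊥-elim (¬p (g q))
𝟙-cong f g (no ¬p) (no ¬q) = refl

sum-map-+ : (f g : ℕ → ℕ) (js : List ℕ) → sum (map (λ j → f j + g j) js) ≡ sum (map f js) + sum (map g js)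
sum-map-+ f g []       = refl
sum-map-+ f g (j ∷ js) rewrite sum-map-+ f g js = interchange (f j) (g j) (sum (map f js)) (sum (map g js))
  where interchange : ∀ a b c d → a + b + (c + d) ≡ (a + c) + (b + d)
        interchange = ℕ-solve-∀

sum-𝟙-impossible : {P : ℕ → Set} (P? : ∀ j → Dec (P j)) (js : List ℕ) → (∀ j → ¬ P j) → sum (map (λ j → 𝟙 (P? j)) js) ≡ 0
sum-𝟙-impossible P? []       ¬P = refl
sum-𝟙-impossible P? (j ∷ js) ¬P = cong₂ _+_ (𝟙-no (¬P j) (P? j)) (sum-𝟙-impossible P? js ¬P)

module _ {A : Set} where

  length-filter-∷ : {P : A → Set} (P? : Decidable P) (x : A) (xs : List A) →
    length (filter P? (x ∷ xs)) ≡ 𝟙 (P? x) + length (filter P? xs)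
  length-filter-∷ P? x xs with P? x
  ... | yes _ = refl
  ... | no _  = refl

  count-pos : {P : A → Set} (P? : Decidable P) (xs : List A) (x : A) → x ∈ₗ xs → P x → length (filter P? xs) ≢ 0
  count-pos P? (y ∷ xs) x (here refl) px rewrite length-filter-∷ P? y xs | 𝟙-yes px (P? y) = λ ()
  count-pos P? (y ∷ xs) x (there x∈) px rewrite length-filter-∷ P? y xs =
    λ total≡0 → count-pos P? xs x x∈ px (ℕP.m+n≡0⇒n≡0 (𝟙 (P? y)) total≡0)

  count-witness : {P : A → Set} (P? : Decidable P) (xs : List A) → length (filter P? xs) ≢ 0 → Σ A λ x → x ∈ₗ xs × P x
  count-witness P? []       count≢0 = ⊥-elim (count≢0 refl)
  count-witness P? (x ∷ xs) count≢0 with P? x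
  ... | yes px = x , here refl , px
  ... | no _ with count-witness P? xs count≢0
  ...   | y , y∈ , py = y , there y∈ , py

  double-count : {P : ℕ → A → Set} (P? : ∀ j → Decidable (P j)) {Q : A → Set} (Q? : Decidable Q)
    (js : List ℕ) (xs : List A) →
    (∀ x → sum (map (λ j → 𝟙 (P? j x)) js) ≡ 𝟙 (Q? x)) →
    sum (map (λ j → length (filter (P? j) xs)) js) ≡ length (filter Q? xs)
  double-count P? Q? js [] pointwise = sum-𝟙-impossible {P = λ _ → ⊥} (λ _ → no (λ ())) js (λ _ ())
  double-count P? Q? js (x ∷ xs) pointwise = begin
      sum (map (λ j → length (filter (P? j) (x ∷ xs))) js)
    ≡⟨ cong sum (map-cong (λ j → length-filter-∷ (P? j) x xs) js) ⟩
      sum (map (λ j → 𝟙 (P? j x) + length (filter (P? j) xs)) js)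
    ≡⟨ sum-map-+ (λ j → 𝟙 (P? j x)) (λ j → length (filter (P? j) xs)) js ⟩
      sum (map (λ j → 𝟙 (P? j x)) js) + sum (map (λ j → length (filter (P? j) xs)) js)
    ≡⟨ cong₂ _+_ (pointwise x) (double-count P? Q? js xs pointwise) ⟩
      𝟙 (Q? x) + length (filter Q? xs)
    ≡⟨ sym (length-filter-∷ Q? x xs) ⟩
      length (filter Q? (x ∷ xs))
    ∎
    where open ≡-Reasoning

window-indicator : ∀ L j₀ m →
  sum (map (λ j → 𝟙 (j₀ + j ℕ.≟ m)) (upTo L)) ≡ 𝟙 ((j₀ ℕ.≤? m) ×-dec (m ℕ.<? j₀ + L))
window-indicator zero j₀ m = sym (𝟙-no empty _)
  where empty : ¬ (j₀ ≤ m × m < j₀ + 0)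
        empty (j₀≤m , m<j₀) = ℕP.<-irrefl refl (ℕP.<-≤-trans m<j₀ (subst (_≤ m) (sym (ℕP.+-identityʳ j₀)) j₀≤m))
window-indicator (suc L) j₀ m = begin
    sum (map f (upTo (suc L)))
  ≡⟨ cong (λ l → sum (map f l)) (sym (upTo-∷ʳ L)) ⟩
    sum (map f (upTo L ++ [ L ]))
  ≡⟨ cong sum (map-++ f (upTo L) [ L ]) ⟩
    sum (map f (upTo L) ++ [ f L ])
  ≡⟨ sum-++ (map f (upTo L)) [ f L ] ⟩
    sum (map f (upTo L)) + (f L + 0)
  ≡⟨ cong₂ _+_ (window-indicator L j₀ m) (ℕP.+-identityʳ (f L)) ⟩
    𝟙 ((j₀ ℕ.≤? m) ×-dec (m ℕ.<? j₀ + L)) + f L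
  ≡⟨ extend (j₀ + L ℕ.≟ m) ⟩
    𝟙 ((j₀ ℕ.≤? m) ×-dec (m ℕ.<? j₀ + suc L))
  ∎
  where
  open ≡-Reasoning
  f : ℕ → ℕ
  f j = 𝟙 (j₀ + j ℕ.≟ m)
  extend : (hit : Dec (j₀ + L ≡ m)) →
    𝟙 ((j₀ ℕ.≤? m) ×-dec (m ℕ.<? j₀ + L)) + 𝟙 hit ≡ 𝟙 ((j₀ ℕ.≤? m) ×-dec (m ℕ.<? j₀ + suc L))
  extend (yes refl) = trans (cong (_+ 1) (𝟙-no (λ (_ , m<m) → ℕP.<-irrefl refl m<m) _))
                        (sym (𝟙-yes (ℕP.m≤m+n j₀ L , ℕP.≤-reflexive (sym (ℕP.+-suc j₀ L))) _))
  extend (no miss) = trans (ℕP.+-identityʳ _) (𝟙-cong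
    (λ (j₀≤m , m<) → j₀≤m , ℕP.<-trans m< (ℕP.≤-reflexive (sym (ℕP.+-suc j₀ L))))
    (λ (j₀≤m , m<) → j₀≤m , ℕP.≤∧≢⇒< (ℕP.≤-pred (ℕP.≤-trans m< (ℕP.≤-reflexive (ℕP.+-suc j₀ L)))) (λ e → miss (sym e)))
    _ _)

module _ (R : OrderedCommutativeRing 0ℓ 0ℓ 0ℓ) where
  open OrderedCommutativeRing R
    renaming (_<_ to infix 4 _<ᴿ_; _+_ to infixl 6 _+ᴿ_; _*_ to infixl 7 _*ᴿ_; refl to ≈-refl; sym to ≈-sym; trans to ≈-trans)

  NonNeg : Carrier → Set
  NonNeg a = 0# <ᴿ a ⊎ 0# ≈ a

  pos+nonneg : ∀ {a b} → 0# <ᴿ a → NonNeg b → 0# <ᴿ a +ᴿ b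
  pos+nonneg {a} {b} 0<a (inj₁ 0<b) = <-trans (<-respʳ-≈ (≈-sym (+-identityˡ b)) 0<b) (+-mono-< b 0<a)
  pos+nonneg {a} {b} 0<a (inj₂ 0≈b) = <-respʳ-≈ (≈-trans (≈-sym (+-identityʳ a)) (+-congˡ 0≈b)) 0<a

  nonneg+pos : ∀ {a b} → NonNeg a → 0# <ᴿ b → 0# <ᴿ a +ᴿ b
  nonneg+pos {a} {b} 0≤a 0<b = <-respʳ-≈ (+-comm b a) (pos+nonneg 0<b 0≤a)

  nonneg+nonneg : ∀ {a b} → NonNeg a → NonNeg b → NonNeg (a +ᴿ b)
  nonneg+nonneg (inj₁ 0<a) 0≤b         = inj₁ (pos+nonneg 0<a 0≤b)
  nonneg+nonneg (inj₂ 0≈a) (inj₁ 0<b)  = inj₁ (nonneg+pos (inj₂ 0≈a) 0<b)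
  nonneg+nonneg (inj₂ 0≈a) (inj₂ 0≈b)  = inj₂ (≈-trans (≈-sym (+-identityʳ 0#)) (+-cong 0≈a 0≈b))

  fromℕ-nonneg : ∀ m → NonNeg (fromℕ m)
  fromℕ-nonneg zero    = inj₂ ≈-refl
  fromℕ-nonneg (suc m) = inj₁ (pos+nonneg 0<1 (fromℕ-nonneg m))

  pow-pos : ∀ {x} → 0# <ᴿ x → ∀ j → 0# <ᴿ pow x j
  pow-pos 0<x zero    = 0<1
  pow-pos 0<x (suc j) = *-pos 0<x (pow-pos 0<x j)

  term-pos : ∀ {x} → 0# <ᴿ x → ∀ m j → 0# <ᴿ fromℕ (suc m) *ᴿ pow x j
  term-pos 0<x m j = *-pos (pos+nonneg 0<1 (fromℕ-nonneg m)) (pow-pos 0<x j)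

  term-nonneg : ∀ {x} → 0# <ᴿ x → ∀ m j → NonNeg (fromℕ m *ᴿ pow x j)
  term-nonneg 0<x zero    j = inj₂ (≈-sym (zeroˡ (pow _ j)))
  term-nonneg 0<x (suc m) j = inj₁ (term-pos 0<x m j)

  evalPoly-nonneg : ∀ {x} → 0# <ᴿ x → (a : ℕ → ℕ) (js : List ℕ) → NonNeg (evalPoly a js x)
  evalPoly-nonneg 0<x a []       = inj₂ ≈-refl
  evalPoly-nonneg 0<x a (j ∷ js) = nonneg+nonneg (term-nonneg 0<x (a j) j) (evalPoly-nonneg 0<x a js)

  evalPoly-pos : ∀ {x} → 0# <ᴿ x → (a : ℕ → ℕ) (js : List ℕ) (j₀ : ℕ) → j₀ ∈ₗ js → a j₀ ≢ 0 → 0# <ᴿ evalPoly a js x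
  evalPoly-pos 0<x a (j ∷ js) j (here refl) a≢0 with a j
  ... | zero  = ⊥-elim (a≢0 refl)
  ... | suc m = pos+nonneg (term-pos 0<x m j) (evalPoly-nonneg 0<x a js)
  evalPoly-pos 0<x a (j ∷ js) j₀ (there j₀∈) a≢0 =
    nonneg+pos (term-nonneg 0<x (a j) j) (evalPoly-pos 0<x a js j₀ j₀∈ a≢0)

  no-positive-zero : (a : ℕ → ℕ) (js : List ℕ) (j₀ : ℕ) → j₀ ∈ₗ js → a j₀ ≢ 0 →
    ∀ x → evalPoly a js x ≈ 0# → ¬ (0# <ᴿ x)
  no-positive-zero a js j₀ j₀∈ a≢0 x root 0<x = <-irrefl ≈-refl (<-respʳ-≈ root (evalPoly-pos 0<x a js j₀ j₀∈ a≢0))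

IsSign : ℤ → Set
IsSign s = s ≡ + 1 ⊎ s ≡ - (+ 1)

sign-* : ∀ {a b} → IsSign a → IsSign b → IsSign (a ℤ.* b)
sign-* (inj₁ refl) (inj₁ refl) = inj₁ refl
sign-* (inj₁ refl) (inj₂ refl) = inj₂ refl
sign-* (inj₂ refl) (inj₁ refl) = inj₂ refl
sign-* (inj₂ refl) (inj₂ refl) = inj₁ refl

sign-square : ∀ {a} → IsSign a → a ℤ.* a ≡ + 1
sign-square (inj₁ refl) = refl
sign-square (inj₂ refl) = refl

sign-solve : ∀ {a} b c → IsSign a → c ≡ a ℤ.* b → b ≡ a ℤ.* c
sign-solve {a} b c ±a c≡ab = begin
    b               ≡⟨ sym (ℤP.*-identityˡ b) ⟩
    + 1 ℤ.* b       ≡⟨ cong (ℤ._* b) (sym (sign-square ±a)) ⟩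
    a ℤ.* a ℤ.* b   ≡⟨ ℤP.*-assoc a a b ⟩
    a ℤ.* (a ℤ.* b) ≡⟨ cong (a ℤ.*_) (sym c≡ab) ⟩
    a ℤ.* c         ∎
  where open ≡-Reasoning

negOnePow-+ : ∀ a b → negOnePow (a + b) ≡ negOnePow a ℤ.* negOnePow b
negOnePow-+ zero    b = sym (ℤP.*-identityˡ _)
negOnePow-+ (suc a) b = trans (cong -_ (negOnePow-+ a b)) (ℤP.neg-distribˡ-* (negOnePow a) (negOnePow b))

negOnePow-parity : ∀ m → (2 ∣ m × negOnePow m ≡ + 1) ⊎ (¬ (2 ∣ m) × negOnePow m ≡ - (+ 1))
negOnePow-parity zero          = inj₁ (divides 0 refl , refl)
negOnePow-parity (suc zero)    = inj₂ ((λ 2∣1 → ℕP.<-irrefl refl (∣⇒≤ 2∣1)) , refl)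
negOnePow-parity (suc (suc m)) with negOnePow-parity m
... | inj₁ (2∣m , e)  = inj₁ (∣m∣n⇒∣m+n ∣-refl 2∣m , trans (ℤP.neg-involutive _) e)
... | inj₂ (2∤m , e)  = inj₂ ((λ 2∣m+2 → 2∤m (∣m+n∣m⇒∣n 2∣m+2 ∣-refl)) , trans (ℤP.neg-involutive _) e)

negOnePow-sign : ∀ m → IsSign (negOnePow m)
negOnePow-sign m with negOnePow-parity m
... | inj₁ (_ , e) = inj₁ e
... | inj₂ (_ , e) = inj₂ e

negOnePow-double : ∀ m → negOnePow (m + m) ≡ + 1
negOnePow-double m = trans (negOnePow-+ m m) (sign-square (negOnePow-sign m))

1≢-1 : + 1 ≢ - (+ 1)
1≢-1 ()

even⇔one : ∀ m → 2 ∣ m ⇔ negOnePow m ≡ + 1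
even⇔one m with negOnePow-parity m
... | inj₁ (2∣m , e) = mk⇔ (λ _ → e) (λ _ → 2∣m)
... | inj₂ (2∤m , e) = mk⇔ (λ 2∣m → ⊥-elim (2∤m 2∣m)) (λ e′ → ⊥-elim (1≢-1 (trans (sym e′) e)))

odd⇔minus-one : ∀ m → (¬ (2 ∣ m)) ⇔ negOnePow m ≡ - (+ 1)
odd⇔minus-one m with negOnePow-parity m
... | inj₁ (2∣m , e) = mk⇔ (λ 2∤m → ⊥-elim (2∤m 2∣m)) (λ e′ → ⊥-elim (1≢-1 (trans (sym e) e′)))
... | inj₂ (2∤m , e) = mk⇔ (λ _ → e) (λ _ → 2∤m)

uniform-parity : ∀ {X : Set} (f : X → ℕ) →
  ((∀ x → 2 ∣ f x) ⊎ (∀ x → ¬ (2 ∣ f x))) ⇔ Σ ℤ λ t → IsSign t × (∀ x → negOnePow (f x) ≡ t)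
uniform-parity f = mk⇔
  (λ { (inj₁ even) → + 1 , inj₁ refl , λ x → Equivalence.to (even⇔one (f x)) (even x)
     ; (inj₂ odd)  → - (+ 1) , inj₂ refl , λ x → Equivalence.to (odd⇔minus-one (f x)) (odd x) })
  (λ { (_ , inj₁ refl , constant) → inj₁ λ x → Equivalence.from (even⇔one (f x)) (constant x)
     ; (_ , inj₂ refl , constant) → inj₂ λ x → Equivalence.from (odd⇔minus-one (f x)) (constant x) })

SignedBy : (ℕ → ℕ) → ℤ → Set
SignedBy a s = ∀ j → a j ≢ 0 → negOnePow j ≡ s

even-or-odd⇔signed : (a : ℕ → ℕ) → (EvenPoly a ⊎ OddPoly a) ⇔ Σ ℤ λ s → IsSign s × SignedBy a s
even-or-odd⇔signed a = mk⇔ to from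
  where
  to : EvenPoly a ⊎ OddPoly a → Σ ℤ λ s → IsSign s × SignedBy a s
  to (inj₁ even) = + 1 , inj₁ refl , λ j a≢0 → even-term (negOnePow-sign j) (a j) a≢0 (even j)
    where even-term : ∀ {s} → IsSign s → ∀ c → c ≢ 0 → s ℤ.* + c ≡ + c → s ≡ + 1
          even-term (inj₁ e)    c       c≢0 _ = e
          even-term (inj₂ refl) zero    c≢0 _ = ⊥-elim (c≢0 refl)
          even-term (inj₂ refl) (suc c) c≢0 ()
  to (inj₂ odd) = - (+ 1) , inj₂ refl , λ j a≢0 → odd-term (negOnePow-sign j) (a j) a≢0 (odd j)
    where odd-term : ∀ {s} → IsSign s → ∀ c → c ≢ 0 → s ℤ.* + c ≡ - (+ c) → s ≡ - (+ 1)
          odd-term (inj₂ e)    c       c≢0 _ = e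
          odd-term (inj₁ refl) zero    c≢0 _ = ⊥-elim (c≢0 refl)
          odd-term (inj₁ refl) (suc c) c≢0 e with trans (sym (ℤP.*-identityˡ (+ suc c))) e
          ... | ()
  signed-term : ∀ s → SignedBy a s → ∀ j → negOnePow j ℤ.* + a j ≡ s ℤ.* + a j
  signed-term s signed j with a j ℕ.≟ 0
  ... | yes a≡0 rewrite a≡0 = trans (ℤP.*-zeroʳ (negOnePow j)) (sym (ℤP.*-zeroʳ s))
  ... | no a≢0 = cong (ℤ._* + a j) (signed j a≢0)
  from : Σ ℤ (λ s → IsSign s × SignedBy a s) → EvenPoly a ⊎ OddPoly a
  from (s , inj₁ refl , signed) = inj₁ λ j → trans (signed-term s signed j) (ℤP.*-identityˡ (+ a j))
  from (s , inj₂ refl , signed) = inj₂ λ j → trans (signed-term s signed j) (ℤP.-1*i≡-i (+ a j))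

card-split : ∀ {n} (X Y : Subset n) → ∣ X ∩ Y ∣ + ∣ ∁ X ∩ Y ∣ ≡ ∣ Y ∣
card-split []          []          = refl
card-split (true ∷ X)  (true ∷ Y)  = cong suc (card-split X Y)
card-split (true ∷ X)  (false ∷ Y) = card-split X Y
card-split (false ∷ X) (true ∷ Y)  = trans (ℕP.+-suc _ _) (cong suc (card-split X Y))
card-split (false ∷ X) (false ∷ Y) = card-split X Y

card-empty : ∀ {n} (X : Subset n) → (∀ x → x ∉ X) → ∣ X ∣ ≡ 0
card-empty {n} X none rewrite Empty-unique {p = X} (λ (x , x∈X) → none x x∈X) = ∣⊥∣≡0 n

∈-tabulate⁺ : ∀ {n} (f : Fin n → Bool) w → f w ≡ true → w ∈ tabulate f
∈-tabulate⁺ f w fw = VecP.lookup⇒[]= w (tabulate f) (trans (VecP.lookup∘tabulate f w) fw)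

∈-tabulate⁻ : ∀ {n} (f : Fin n → Bool) w → w ∈ tabulate f → f w ≡ true
∈-tabulate⁻ f w w∈ = trans (sym (VecP.lookup∘tabulate f w)) (VecP.[]=⇒lookup w∈)

∈-subsets : ∀ {n} (S : Subset n) → S ∈ₗ subsets n
∈-subsets []                = here refl
∈-subsets {suc n} (true ∷ S)  = ∈-++⁺ˡ (∈-map⁺ (true ∷_) (∈-subsets S))
∈-subsets {suc n} (false ∷ S) = ∈-++⁺ʳ (map (true ∷_) (subsets n)) (∈-map⁺ (false ∷_) (∈-subsets S))

largest : ∀ {n} {Q : Subset n → Set} (Q? : Decidable Q) (X₀ : Subset n) → Q X₀ →
  Σ (Subset n) λ X → Q X × (∀ Y → Q Y → ∣ Y ∣ ≤ ∣ X ∣)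
largest {n} Q? X₀ qX₀ = X , argmax-all ∣_∣ qX₀ (all-filter Q? (subsets n)) ,
  λ Y qY → All.lookup (f[xs]≤f[argmax] {f = ∣_∣} X₀ candidates) (∈-filter⁺ Q? (∈-subsets Y) qY)
  where
  candidates : List (Subset n)
  candidates = filter Q? (subsets n)
  X : Subset n
  X = argmax ∣_∣ X₀ candidates

last-true : ∀ {P : ℕ → Set} → Decidable P → P 0 → ∀ N → ¬ P N → Σ ℕ λ m → m < N × P m × ¬ P (suc m)
last-true P? p0 zero    ¬pN = ⊥-elim (¬pN p0)
last-true P? p0 (suc N) ¬pN with P? N
... | yes pN = N , ℕP.≤-refl , pN , ¬pN
... | no ¬pN′ with last-true P? p0 N ¬pN′
...   | m , m<N , pm , ¬pm = m , ℕP.m≤n⇒m≤1+n m<N , pm , ¬pm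

injection-length : ∀ {k} (e : Fin k → ℕ) (L : List ℕ) → Injective _≡_ _≡_ e → (∀ i → e i ∈ₗ L) → k ≤ length L
injection-length {k} e L e-inj e∈L with k ℕ.≤? length L
... | yes k≤ = k≤
... | no k≰ with FinP.pigeonhole (ℕP.≰⇒> k≰) (λ i → index (e∈L i))
...   | i , j , i<j , same = ⊥-elim (FinP.<-irrefl (e-inj
          (trans (lookup-index (e∈L i)) (trans (cong (Data.List.lookup L) same) (sym (lookup-index (e∈L j)))))) i<j)

module Alliances {n : ℕ} (G : Graph n) where
  open Graph G using (adj; irrefl) renaming (sym to adj-sym)

  Δ : ℕ
  Δ = δ₁ G

  δ : Subset n → Fin n → ℕ
  δ S v = δ[_] G S v

  degree-split : ∀ S v → δ S v + δ (∁ S) v ≡ deg G v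
  degree-split S v = card-split S (N G v)

  ∈N⁺ : ∀ v w → adj v w ≡ true → w ∈ N G v
  ∈N⁺ v = ∈-tabulate⁺ (adj v)

  ∈N⁻ : ∀ v w → w ∈ N G v → adj v w ≡ true
  ∈N⁻ v = ∈-tabulate⁻ (adj v)

  deg≤Δ : ∀ v → deg G v ≤ Δ
  deg≤Δ v = All.lookup
    (foldr-forcesᵇ {P = _≤ Δ} (λ x y x⊔y≤Δ → ℕP.m⊔n≤o⇒m≤o x y x⊔y≤Δ , ℕP.m⊔n≤o⇒n≤o x y x⊔y≤Δ)
      0 (map (deg G) (allFin n)) ℕP.≤-refl)
    (∈-map⁺ (deg G) (∈-allFin v))

  Δ-attained : 0 < n → Σ (Fin n) λ v → deg G v ≡ Δ
  Δ-attained 0<n with foldr-selective ℕP.⊔-sel 0 (map (deg G) (allFin n))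
  ... | inj₁ Δ≡0 = v₀ , ℕP.≤-antisym (deg≤Δ v₀) (subst (_≤ deg G v₀) (sym Δ≡0) z≤n)
    where v₀ : Fin n
          v₀ = fromℕ< 0<n
  ... | inj₂ Δ∈ with ∈-map⁻ (deg G) Δ∈
  ...   | v , _ , Δ≡deg = v , sym Δ≡deg

  δₙ≤deg : ∀ v → δₙ G ≤ deg G v
  δₙ≤deg v = All.lookup
    (foldr-forcesᵇ {P = δₙ G ≤_} (λ x y δₙ≤x⊓y → ℕP.m≤n⊓o⇒m≤n x y δₙ≤x⊓y , ℕP.m≤n⊓o⇒m≤o x y δₙ≤x⊓y)
      Δ (map (deg G) (allFin n)) ℕP.≤-refl)
    (∈-map⁺ (deg G) (∈-allFin v))

  δₙ-attained : 0 < n → Σ (Fin n) λ v → deg G v ≡ δₙ G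
  δₙ-attained 0<n with foldr-selective ℕP.⊓-sel Δ (map (deg G) (allFin n))
  ... | inj₁ δₙ≡Δ with Δ-attained 0<n
  ...   | v , deg≡Δ = v , trans deg≡Δ (sym δₙ≡Δ)
  δₙ-attained 0<n | inj₂ δₙ∈ with ∈-map⁻ (deg G) δₙ∈
  ...   | v , _ , δₙ≡deg = v , sym δₙ≡deg

  -- No loops: v is not its own neighbour, so deg v < n.
  deg<n : ∀ v → deg G v < n
  deg<n v = ℕP.<-≤-trans (p⊂q⇒∣p∣<∣q∣ ((λ _ → ∈⊤) , v , ∈⊤ , λ v∈Nv → no-loop (∈N⁻ v v v∈Nv))) (ℕP.≤-reflexive (∣⊤∣≡n n))
    where no-loop : adj v v ≢ true
          no-loop loop with trans (sym loop) (irrefl v)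
          ... | ()

  Δ<n : 0 < n → Δ < n
  Δ<n 0<n with Δ-attained 0<n
  ... | v , deg≡Δ = subst (_< n) deg≡Δ (deg<n v)

  deg-pos : ∀ v w → adj v w ≡ true → 0 < deg G v
  deg-pos v w vw = ℕP.<-≤-trans (ℕP.≤-reflexive (sym (∣⁅x⁆∣≡1 w)))
    (p⊆q⇒∣p∣≤∣q∣ (λ x∈⁅w⁆ → subst (_∈ N G v) (sym (x∈⁅y⁆⇒x≡y w x∈⁅w⁆)) (∈N⁺ v w vw)))

  -- "S is a defensive (shift Δ i)-alliance", with both sides moved into ℕ.
  Alliance : Subset n → ℕ → Set
  Alliance S i = ∀ v → v ∈ S → δ (∁ S) v + i ≤ δ S v + Δ

  alliance? : ∀ S → Decidable (Alliance S)
  alliance? S i = map′ (λ f v → f v) (λ f v → f v)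
    (FinP.all? (λ v → v ∈? S →-dec (δ (∁ S) v + i ℕ.≤? δ S v + Δ)))

  alliance-downward : ∀ S {i j} → i ≤ j → Alliance S j → Alliance S i
  alliance-downward S i≤j allied v v∈S = ℕP.≤-trans (ℕP.+-monoʳ-≤ _ i≤j) (allied v v∈S)

  -- Every set is a (-Δ)-alliance, since δ_S̄(v) ≤ deg v ≤ Δ.
  alliance-zero : ∀ S → Alliance S 0
  alliance-zero S v v∈S = ℕP.≤-trans (ℕP.≤-reflexive (ℕP.+-identityʳ _))
    (ℕP.≤-trans (ℕP.≤-trans (∣p∩q∣≤∣q∣ (∁ S) (N G v)) (deg≤Δ v)) (ℕP.m≤n+m Δ _))

  -- No nonempty set is a k-alliance for k > Δ, since δ_S(v) ≤ Δ.
  alliance-bound : ∀ S {i} → Nonempty S → Alliance S i → i ≤ Δ + Δ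
  alliance-bound S {i} (v , v∈S) allied = begin
    i                 ≤⟨ ℕP.m≤n+m i _ ⟩
    δ (∁ S) v + i     ≤⟨ allied v v∈S ⟩
    δ S v + Δ         ≤⟨ ℕP.+-monoˡ-≤ Δ (ℕP.≤-trans (∣p∩q∣≤∣q∣ S (N G v)) (deg≤Δ v)) ⟩
    Δ + Δ             ∎
    where open ℕP.≤-Reasoning

  defAlliance⇒ : ∀ S i → DefAlliance G S (shift Δ i) → Alliance S i
  defAlliance⇒ S i (_ , allied) v v∈S =
    Equivalence.to (shift-alliance (δ (∁ S) v) (δ S v) Δ i) (allied v v∈S)

  defAlliance⇐ : ∀ S i → Nonempty S → Alliance S i → DefAlliance G S (shift Δ i)
  defAlliance⇐ S i ne allied = ne , λ v v∈S →
    Equivalence.from (shift-alliance (δ (∁ S) v) (δ S v) Δ i) (allied v v∈S)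

  𝒦⁻ : ∀ k → k ∈ₗ 𝒦 G → Σ ℕ λ i → i ≤ Δ + Δ × k ≡ shift Δ i
  𝒦⁻ k k∈𝒦 with ∈-map⁻ (shift Δ) k∈𝒦
  ... | i , i∈ , k≡ = i , ℕP.≤-pred (∈-upTo⁻ i∈) , k≡

  𝒦⁺ : ∀ i → i ≤ Δ + Δ → shift Δ i ∈ₗ 𝒦 G
  𝒦⁺ i i≤ = ∈-map⁺ (shift Δ) (∈-upTo⁺ (s≤s i≤))

  -- m is the (shifted) exact index of S: the largest m with S an m-alliance.
  IsIndex : Subset n → ℕ → Set
  IsIndex S m = Nonempty S × Alliance S m × ¬ Alliance S (suc m)

  -- The index dominates every i at which S is an alliance, and every
  -- nonempty S has one (alliances hold at 0 and fail beyond 2Δ).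
  index-max : ∀ S m {i} → IsIndex S m → Alliance S i → i ≤ m
  index-max S m {i} (_ , _ , ¬allied) allied with i ℕ.≤? m
  ... | yes i≤m = i≤m
  ... | no i≰m  = ⊥-elim (¬allied (alliance-downward S (ℕP.≰⇒> i≰m) allied))

  index-exists : ∀ S → Nonempty S → Σ ℕ (IsIndex S)
  index-exists S ne with last-true (alliance? S) (alliance-zero S) (suc (Δ + Δ))
                           (λ allied → ℕP.<-irrefl refl (alliance-bound S ne allied))
  ... | m , _ , allied , ¬allied = m , ne , allied , ¬allied

  exactIndex⇒ : ∀ S m k → IsIndex S m → ExactIndex G S k → k ≡ shift Δ m
  exactIndex⇒ S m k idx@(ne , allied , _) (k∈𝒦 , k-allied , k-max) with 𝒦⁻ k k∈𝒦
  ... | i , _ , refl = cong (shift Δ) (ℕP.≤-antisym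
        (index-max S m idx (defAlliance⇒ S i k-allied))
        (Equivalence.to (shift-≤ Δ m i)
          (k-max (shift Δ m) (𝒦⁺ m (alliance-bound S ne allied)) (defAlliance⇐ S m ne allied))))

  exactIndex⇐ : ∀ S m → IsIndex S m → ExactIndex G S (shift Δ m)
  exactIndex⇐ S m idx@(ne , allied , _) =
    𝒦⁺ m (alliance-bound S ne allied) , defAlliance⇐ S m ne allied , below
    where
    below : ∀ k′ → k′ ∈ₗ 𝒦 G → DefAlliance G S k′ → k′ ℤ.≤ shift Δ m
    below k′ k′∈𝒦 k′-allied with 𝒦⁻ k′ k′∈𝒦
    ... | i , _ , refl = Equivalence.from (shift-≤ Δ i m) (index-max S m idx (defAlliance⇒ S i k′-allied))

  exactIndex⇔ : ∀ S m i → IsIndex S m → ExactIndex G S (shift Δ i) ⇔ i ≡ m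
  exactIndex⇔ S m i idx = mk⇔
    (λ exact → shift-injective Δ i m (exactIndex⇒ S m _ idx exact))
    (λ { refl → exactIndex⇐ S m idx })

  tight-vertex : ∀ S m → IsIndex S m → Σ (Fin n) λ v → v ∈ S × δ (∁ S) v + m ≡ δ S v + Δ
  tight-vertex S m (_ , allied , ¬allied)
    with FinP.¬∀⟶∃¬ n (λ v → v ∈ S → δ (∁ S) v + suc m ≤ δ S v + Δ)
           (λ v → v ∈? S →-dec (δ (∁ S) v + suc m ℕ.≤? δ S v + Δ)) ¬allied
  ... | v , violated with v ∈? S
  ...   | no v∉S  = ⊥-elim (violated (λ v∈S → ⊥-elim (v∉S v∈S)))
  ...   | yes v∈S = v , v∈S , ℕP.≤-antisym (allied v v∈S)
            (ℕP.≤-pred (ℕP.≤-trans (ℕP.≰⇒> (λ le → violated (λ _ → le))) (ℕP.≤-reflexive (ℕP.+-suc _ m))))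

  -- A single vertex v has δ_{v}(v) = 0 and δ_{v̄}(v) = deg v, so k_{v} = -deg v.
  index-singleton : ∀ v → IsIndex ⁅ v ⁆ (Δ ∸ deg G v)
  index-singleton v = (v , x∈⁅x⁆ v) , allied , ¬allied
    where
    inside : δ ⁅ v ⁆ v ≡ 0
    inside = card-empty (⁅ v ⁆ ∩ N G v) λ x x∈ → no-loop x (x∈p∩q⁻ ⁅ v ⁆ (N G v) x∈)
      where no-loop : ∀ x → x ∈ ⁅ v ⁆ × x ∈ N G v → ⊥
            no-loop x (x∈⁅v⁆ , x∈Nv) rewrite x∈⁅y⁆⇒x≡y v x∈⁅v⁆ with trans (sym (∈N⁻ v v x∈Nv)) (irrefl v)
            ... | ()
    outside : δ (∁ ⁅ v ⁆) v ≡ deg G v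
    outside = trans (cong (_+ δ (∁ ⁅ v ⁆) v) (sym inside)) (degree-split ⁅ v ⁆ v)
    allied : Alliance ⁅ v ⁆ (Δ ∸ deg G v)
    allied w w∈ rewrite x∈⁅y⁆⇒x≡y v w∈ | inside | outside = ℕP.≤-reflexive (ℕP.m+[n∸m]≡n (deg≤Δ v))
    ¬allied : ¬ Alliance ⁅ v ⁆ (suc (Δ ∸ deg G v))
    ¬allied allied′ with allied′ v (x∈⁅x⁆ v)
    ... | too-big rewrite inside | outside | ℕP.+-suc (deg G v) (Δ ∸ deg G v) | ℕP.m+[n∸m]≡n (deg≤Δ v) =
      ℕP.<-irrefl refl too-big

  -- S is closed under adjacency (a union of connected components).
  Closed : Subset n → Set
  Closed S = ∀ v w → v ∈ S → adj v w ≡ true → w ∈ S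

  -- In a closed set every neighbour is inside, so the alliance condition
  -- reads i ≤ deg v + Δ.
  closed-alliance : ∀ S i → Closed S → Alliance S i ⇔ (∀ v → v ∈ S → i ≤ deg G v + Δ)
  closed-alliance S i closed = mk⇔
    (λ allied v v∈S → subst₂ _≤_ (cong (_+ i) (outside v v∈S)) (cong (_+ Δ) (inside v v∈S)) (allied v v∈S))
    (λ bound v v∈S → subst₂ _≤_ (cong (_+ i) (sym (outside v v∈S))) (cong (_+ Δ) (sym (inside v v∈S))) (bound v v∈S))
    where
    outside : ∀ v → v ∈ S → δ (∁ S) v ≡ 0
    outside v v∈S = card-empty (∁ S ∩ N G v) λ x x∈ → escape (x∈p∩q⁻ (∁ S) (N G v) x∈)
      where escape : ∀ {x} → x ∈ ∁ S × x ∈ N G v → ⊥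
            escape {x} (x∉S , x∈Nv) = x∈∁p⇒x∉p x∉S (closed v x v∈S (∈N⁻ v x x∈Nv))
    inside : ∀ v → v ∈ S → δ S v ≡ deg G v
    inside v v∈S = trans (sym (ℕP.+-identityʳ _)) (trans (cong (λ z → δ S v + z) (sym (outside v v∈S))) (degree-split S v))

  index-closed : ∀ S u → Closed S → u ∈ S → (∀ v → v ∈ S → deg G u ≤ deg G v) → IsIndex S (Δ + deg G u)
  index-closed S u closed u∈S least = (u , u∈S) ,
    Equivalence.from (closed-alliance S _ closed)
      (λ v v∈S → ℕP.≤-trans (ℕP.≤-reflexive (ℕP.+-comm Δ (deg G u))) (ℕP.+-monoˡ-≤ Δ (least v v∈S))) ,
    λ allied → ℕP.<-irrefl refl (ℕP.≤-trans (Equivalence.to (closed-alliance S _ closed) allied u u∈S)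
                                             (ℕP.≤-reflexive (ℕP.+-comm (deg G u) Δ)))

  walk-lift : ∀ {S T} → S ⊆ T → ∀ {a b} → WalkIn G S a b → WalkIn G T a b
  walk-lift S⊆T (stay a∈)      = stay (S⊆T a∈)
  walk-lift S⊆T (step a∈ e w) = step (S⊆T a∈) e (walk-lift S⊆T w)

  walk-snoc : ∀ {S a b c} → WalkIn G S a b → adj b c ≡ true → c ∈ S → WalkIn G S a c
  walk-snoc (stay b∈)      bc c∈ = step b∈ bc (stay c∈)
  walk-snoc (step a∈ e w) bc c∈ = step a∈ e (walk-snoc w bc c∈)

  connected-singleton : ∀ v → Connected G ⁅ v ⁆
  connected-singleton v a b a∈ b∈ rewrite x∈⁅y⁆⇒x≡y v a∈ | x∈⁅y⁆⇒x≡y v b∈ = stay (x∈⁅x⁆ v)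

  connected-extend : ∀ S v w → Connected G S → v ∈ S → adj v w ≡ true → Connected G (S ∪ ⁅ w ⁆)
  connected-extend S v w conn v∈S vw a b a∈ b∈ with x∈p∪q⁻ S ⁅ w ⁆ a∈ | x∈p∪q⁻ S ⁅ w ⁆ b∈
  ... | inj₁ a∈S | inj₁ b∈S = walk-lift (p⊆p∪q ⁅ w ⁆) (conn a b a∈S b∈S)
  ... | inj₁ a∈S | inj₂ b∈w rewrite x∈⁅y⁆⇒x≡y w b∈w =
    walk-snoc (walk-lift (p⊆p∪q ⁅ w ⁆) (conn a v a∈S v∈S)) vw b∈
  ... | inj₂ a∈w | inj₁ b∈S rewrite x∈⁅y⁆⇒x≡y w a∈w =
    step a∈ (trans (adj-sym w v) vw) (walk-lift (p⊆p∪q ⁅ w ⁆) (conn v b v∈S b∈S))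
  ... | inj₂ a∈w | inj₂ b∈w rewrite x∈⁅y⁆⇒x≡y w a∈w | x∈⁅y⁆⇒x≡y w b∈w = stay b∈

module Terms {n : ℕ} (G : Graph n) (conn? : ∀ S → Dec (Connected G S)) where
  open Alliances G

  cf : ℕ → ℕ
  cf = coeff G conn?

  -- A connected S with ℕ-index m contributes x^j for j + Δ = n + m,
  -- i.e. j = n + k_S.
  Witness : ℕ → Set
  Witness j = Σ (Subset n) λ S → Connected G S × Σ ℕ λ m → IsIndex S m × j + Δ ≡ n + m

  witness⇒term : ∀ j → Witness j → cf j ≢ 0
  witness⇒term j (S , conn , m , idx , j+Δ≡n+m) = count-pos _ (subsets n) S (∈-subsets S)
    (proj₁ idx , conn ,
     subst (ExactIndex G S) (sym (Equivalence.from (shift-exponent j n Δ m) j+Δ≡n+m)) (exactIndex⇐ S m idx))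

  term⇒witness : ∀ j → cf j ≢ 0 → Witness j
  term⇒witness j cf≢0 with count-witness _ (subsets n) cf≢0
  ... | S , _ , (ne , conn , exact) with index-exists S ne
  ...   | m , idx = S , conn , m , idx , Equivalence.to (shift-exponent j n Δ m) (exactIndex⇒ S m _ idx exact)

  -- Every exponent lies in [n - Δ, n + Δ], because the index lies in [0, 2Δ].
  witness-lower : ∀ j → Witness j → n ∸ Δ ≤ j
  witness-lower j (_ , _ , m , _ , j+Δ≡n+m) =
    ℕP.m≤n+o⇒m∸n≤o n Δ (ℕP.≤-trans (ℕP.m≤m+n n m) (ℕP.≤-reflexive (trans (sym j+Δ≡n+m) (ℕP.+-comm j Δ))))

  witness-upper : ∀ j → Witness j → j ≤ n + Δ
  witness-upper j (S , _ , m , (ne , allied , _) , j+Δ≡n+m) = ℕP.+-cancelʳ-≤ Δ j (n + Δ) (begin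
    j + Δ       ≡⟨ j+Δ≡n+m ⟩
    n + m       ≤⟨ ℕP.+-monoʳ-≤ n (alliance-bound S ne allied) ⟩
    n + (Δ + Δ) ≡⟨ ℕP.+-assoc n Δ Δ ⟨
    n + Δ + Δ   ∎)
    where open ℕP.≤-Reasoning

  singleton-term : ∀ v → cf (n ∸ deg G v) ≢ 0
  singleton-term v = witness⇒term (n ∸ d) (⁅ v ⁆ , connected-singleton v , Δ ∸ d , index-singleton v , exponent)
    where
    d : ℕ
    d = deg G v
    exponent : n ∸ d + Δ ≡ n + (Δ ∸ d)
    exponent = begin
      n ∸ d + Δ             ≡⟨ cong (λ z → n ∸ d + z) (ℕP.m+[n∸m]≡n (deg≤Δ v)) ⟨
      n ∸ d + (d + (Δ ∸ d)) ≡⟨ ℕP.+-assoc (n ∸ d) d (Δ ∸ d) ⟨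
      n ∸ d + d + (Δ ∸ d)   ≡⟨ cong (_+ (Δ ∸ d)) (ℕP.m∸n+n≡m (ℕP.<⇒≤ (deg<n v))) ⟩
      n + (Δ ∸ d)           ∎
      where open ≡-Reasoning

  -- The connected component of u: a largest connected set containing u is closed.
  component : ∀ u → Σ (Subset n) λ S → Connected G S × u ∈ S × Closed S
  component u with largest {Q = λ S → Connected G S × u ∈ S} (λ S → conn? S ×-dec (u ∈? S)) ⁅ u ⁆
                     (connected-singleton u , x∈⁅x⁆ u)
  ... | S , (conn , u∈S) , maximal = S , conn , u∈S , closed
    where
    closed : Closed S
    closed v w v∈S vw with w ∈? S
    ... | yes w∈S = w∈S
    ... | no w∉S  = ⊥-elim (ℕP.<-irrefl refl (ℕP.<-≤-trans
            (p⊂q⇒∣p∣<∣q∣ (p⊆p∪q ⁅ w ⁆ , w , x∈p∪q⁺ (inj₂ (x∈⁅x⁆ w)) , w∉S))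
            (maximal (S ∪ ⁅ w ⁆) (connected-extend S v w conn v∈S vw , p⊆p∪q ⁅ w ⁆ u∈S))))

  min-degree-term : 0 < n → cf (n + δₙ G) ≢ 0
  min-degree-term 0<n with δₙ-attained 0<n
  ... | u , deg-u≡δₙ with component u
  ...   | S , conn , u∈S , closed = witness⇒term (n + δₙ G) (S , conn , Δ + deg G u ,
            index-closed S u closed u∈S (λ v _ → subst (_≤ deg G v) (sym deg-u≡δₙ) (δₙ≤deg v)) ,
            exponent)
    where
    exponent : n + δₙ G + Δ ≡ n + (Δ + deg G u)
    exponent = trans (ℕP.+-assoc n (δₙ G) Δ) (cong (λ z → n + z) (trans (ℕP.+-comm (δₙ G) Δ) (cong (λ z → Δ + z) (sym deg-u≡δₙ))))

  -- The component of a non-isolated vertex gives a monomial x^J with J > n: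
  -- all its vertices have positive degree, so its index exceeds Δ.
  high-term : ∀ u w → Graph.adj G u w ≡ true → Σ ℕ λ J → n < J × cf J ≢ 0
  high-term u w uw with component u
  ... | S , conn , u∈S , closed with index-exists S (u , u∈S)
  ...   | m , idx = n + (m ∸ Δ) , n<J , witness⇒term _ (S , conn , m , idx , exponent)
    where
    positive : ∀ v → v ∈ S → 1 + Δ ≤ deg G v + Δ
    positive v v∈S with conn v u v∈S u∈S
    ... | stay _       = ℕP.+-monoˡ-≤ Δ (deg-pos u w uw)
    ... | step _ vx _  = ℕP.+-monoˡ-≤ Δ (deg-pos v _ vx)
    Δ<m : Δ < m
    Δ<m = index-max S m idx (Equivalence.from (closed-alliance S (suc Δ) closed) positive)
    n<J : n < n + (m ∸ Δ)
    n<J = ℕP.≤-trans (ℕP.≤-reflexive (ℕP.+-comm 1 n)) (ℕP.+-monoʳ-≤ n (ℕP.m<n⇒0<n∸m Δ<m))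
    exponent : n + (m ∸ Δ) + Δ ≡ n + m
    exponent = trans (ℕP.+-assoc n (m ∸ Δ) Δ) (cong (λ z → n + z) (ℕP.m∸n+n≡m (ℕP.<⇒≤ Δ<m)))

  -- At a tight vertex v of S, n + k_S ≡ n + deg v (mod 2); hence
  -- (-1)^j = (-1)^{deg v} (-1)^n for every exponent j.
  term-sign : ∀ j → Witness j → Σ (Fin n) λ v → negOnePow j ≡ negOnePow (deg G v) ℤ.* negOnePow n
  term-sign j (S , _ , m , idx , j+Δ≡n+m) with tight-vertex S m idx
  ... | v , _ , tight = v , sign-solve (negOnePow j) (negOnePow n) (negOnePow-sign (deg G v)) (begin
      negOnePow n                                 ≡⟨ ℤP.*-identityʳ (negOnePow n) ⟨
      negOnePow n ℤ.* + 1                         ≡⟨ cong (negOnePow n ℤ.*_) (negOnePow-double a) ⟨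
      negOnePow n ℤ.* negOnePow (a + a)           ≡⟨ negOnePow-+ n (a + a) ⟨
      negOnePow (n + (a + a))                     ≡⟨ cong negOnePow (same-parity j n m a b Δ j+Δ≡n+m tight) ⟨
      negOnePow (j + (a + b))                     ≡⟨ cong (λ d → negOnePow (j + d)) (degree-split S v) ⟩
      negOnePow (j + deg G v)                     ≡⟨ negOnePow-+ j (deg G v) ⟩
      negOnePow j ℤ.* negOnePow (deg G v)         ≡⟨ ℤP.*-comm (negOnePow j) (negOnePow (deg G v)) ⟩
      negOnePow (deg G v) ℤ.* negOnePow j         ∎)
    where
    open ≡-Reasoning
    a b : ℕ
    a = δ S v
    b = δ (∁ S) v
    same-parity : ∀ j n m a b Δ → j + Δ ≡ n + m → b + m ≡ a + Δ → j + (a + b) ≡ n + (a + a)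
    same-parity j n m a b Δ e₁ e₂ = ℕP.+-cancelʳ-≡ m _ _ (begin
      j + (a + b) + m   ≡⟨ regroup₁ j a b m ⟩
      j + a + (b + m)   ≡⟨ cong (λ z → j + a + z) e₂ ⟩
      j + a + (a + Δ)   ≡⟨ regroup₂ j a Δ ⟩
      (j + Δ) + (a + a) ≡⟨ cong (_+ (a + a)) e₁ ⟩
      n + m + (a + a)   ≡⟨ regroup₃ n m a ⟩
      n + (a + a) + m   ∎)
      where
      regroup₁ : ∀ j a b m → j + (a + b) + m ≡ j + a + (b + m)
      regroup₁ = ℕ-solve-∀
      regroup₂ : ∀ j a Δ → j + a + (a + Δ) ≡ (j + Δ) + (a + a)
      regroup₂ = ℕ-solve-∀
      regroup₃ : ∀ n m a → n + m + (a + a) ≡ n + (a + a) + m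
      regroup₃ = ℕ-solve-∀

module AlliancePolynomial {n : ℕ} (0<n : 0 < n) (G : Graph n) (conn? : ∀ S → Dec (Connected G S)) where
  open Alliances G
  open Terms G conn?

  lowest-term : cf (n ∸ Δ) ≢ 0
  lowest-term with Δ-attained 0<n
  ... | v , deg≡Δ = subst (λ d → cf (n ∸ d) ≢ 0) deg≡Δ (singleton-term v)

  -- All exponents are ≤ n + Δ < 2n + 1, so `exps` lists every monomial.
  term∈exps : ∀ j → cf j ≢ 0 → j ∈ₗ exps G conn?
  term∈exps j cf≢0 = ∈-upTo⁺ (s≤s (ℕP.≤-trans (witness-upper j (term⇒witness j cf≢0))
                                               (ℕP.+-monoʳ-≤ n (ℕP.<⇒≤ (Δ<n 0<n)))))

  -- (i) A(Γ;x) has natural coefficients and is nonzero, so has no positive zero.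
  nonpositive-zeros : (R : OrderedCommutativeRing 0ℓ 0ℓ 0ℓ) (x : OrderedCommutativeRing.Carrier R) →
    OrderedCommutativeRing._≈_ R (OrderedCommutativeRing.evalPoly R cf (exps G conn?) x) (OrderedCommutativeRing.0# R) →
    ¬ (OrderedCommutativeRing._<_ R (OrderedCommutativeRing.0# R) x)
  nonpositive-zeros R = no-positive-zero R cf (exps G conn?) (n ∸ Δ) (term∈exps _ lowest-term) lowest-term

  zero-multiplicity : Δ < n × (∀ j → j < n ∸ Δ → cf j ≡ 0) × cf (n ∸ Δ) ≢ 0
  zero-multiplicity = Δ<n 0<n , below-lowest , lowest-term
    where
    below-lowest : ∀ j → j < n ∸ Δ → cf j ≡ 0
    below-lowest j j<n∸Δ with cf j ℕ.≟ 0
    ... | yes cf≡0 = cf≡0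
    ... | no cf≢0  = ⊥-elim (ℕP.<⇒≱ j<n∸Δ (witness-lower j (term⇒witness j cf≢0)))

  -- (iii) Double counting: a connected S is a k-alliance (k = shift Δ i₀)
  -- iff its index lies in the window [k, Δ], and then it is counted by
  -- exactly one A_{k'} with k' in that window.
  alliances-above : ∀ k → k ∈ₗ 𝒦 G → sumFrom G conn? k ≡ #ConnDefAlliances G conn? k
  alliances-above k k∈𝒦 with 𝒦⁻ k k∈𝒦
  ... | i₀ , i₀≤2Δ , refl =
    trans (cong (λ w → sum (map (λ j → A G conn? (shift Δ i₀ ℤ.+ + j)) (upTo (suc w)))) (window-width Δ i₀ i₀≤2Δ))
          (double-count P? Q? (upTo L) (subsets n) per-subset)
    where
    L : ℕ
    L = suc (Δ + Δ ∸ i₀)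
    P? : ∀ j S → Dec (Nonempty S × Connected G S × ExactIndex G S (shift Δ i₀ ℤ.+ + j))
    P? j S = nonempty? S ×-dec conn? S ×-dec exactIndex? G S (shift Δ i₀ ℤ.+ + j)
    Q? : ∀ S → Dec (DefAlliance G S (shift Δ i₀) × Connected G S)
    Q? S = defAlliance? G S (shift Δ i₀) ×-dec conn? S
    per-subset : ∀ S → sum (map (λ j → 𝟙 (P? j S)) (upTo L)) ≡ 𝟙 (Q? S)
    per-subset S with nonempty? S ×-dec conn? S
    ... | no ¬ne×conn = trans (sum-𝟙-impossible (λ j → P? j S) (upTo L) (λ j (ne , conn , _) → ¬ne×conn (ne , conn)))
                              (sym (𝟙-no (λ ((ne , _) , conn) → ¬ne×conn (ne , conn)) (Q? S)))
    ... | yes (ne , conn) with index-exists S ne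
    ...   | m , idx@(_ , allied , _) =
      trans (cong sum (map-cong (λ j → 𝟙-cong (hit j) (hit⁻¹ j) (P? j S) (i₀ + j ℕ.≟ m)) (upTo L)))
            (trans (window-indicator L i₀ m) (𝟙-cong in-window in-window⁻¹ _ (Q? S)))
      where
      hit : ∀ j → Nonempty S × Connected G S × ExactIndex G S (shift Δ i₀ ℤ.+ + j) → i₀ + j ≡ m
      hit j (_ , _ , exact) = Equivalence.to (exactIndex⇔ S m (i₀ + j) idx) (subst (ExactIndex G S) (shift-+ Δ i₀ j) exact)
      hit⁻¹ : ∀ j → i₀ + j ≡ m → Nonempty S × Connected G S × ExactIndex G S (shift Δ i₀ ℤ.+ + j)
      hit⁻¹ j i₀+j≡m = ne , conn ,
        subst (ExactIndex G S) (sym (shift-+ Δ i₀ j)) (Equivalence.from (exactIndex⇔ S m (i₀ + j) idx) i₀+j≡m)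
      in-window : i₀ ≤ m × m < i₀ + L → DefAlliance G S (shift Δ i₀) × Connected G S
      in-window (i₀≤m , _) = defAlliance⇐ S i₀ ne (alliance-downward S i₀≤m allied) , conn
      in-window⁻¹ : DefAlliance G S (shift Δ i₀) × Connected G S → i₀ ≤ m × m < i₀ + L
      in-window⁻¹ (i₀-allied , _) = index-max S m idx (defAlliance⇒ S i₀ i₀-allied) ,
        ℕP.<-≤-trans (s≤s (alliance-bound S ne allied))
          (ℕP.≤-reflexive (sym (trans (ℕP.+-suc i₀ _) (cong suc (ℕP.m+[n∸m]≡n i₀≤2Δ)))))

  -- (iv) The r degree values give the distinct monomials x^{n - cᵢ} ≠ x^J
  -- (J > n from a non-isolated vertex), and δₙ gives x^{n + δₙ}.
  degree-terms : HasEdge G → (r : ℕ) (c : Fin r → ℕ) → Injective _≡_ _≡_ c →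
    ((i : Fin r) → Σ (Fin n) (λ v → deg G v ≡ c i)) →
    ((v : Fin n) → Σ (Fin r) (λ i → deg G v ≡ c i)) →
    suc r ≤ #terms G conn? × ((i : Fin r) → cf (n ∸ c i) ≢ 0) × cf (n + δₙ G) ≢ 0
  degree-terms (u , w , uw) r c c-inj attained _ = many-terms , value-term , min-degree-term 0<n
    where
    value-term : ∀ i → cf (n ∸ c i) ≢ 0
    value-term i with attained i
    ... | v , deg≡c = subst (λ d → cf (n ∸ d) ≢ 0) deg≡c (singleton-term v)
    c≤n : ∀ i → c i ≤ n
    c≤n i with attained i
    ... | v , deg≡c = subst (_≤ n) deg≡c (ℕP.<⇒≤ (deg<n v))
    high : Σ ℕ λ J → n < J × cf J ≢ 0
    high = high-term u w uw
    J : ℕ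
    J = proj₁ high
    exponent : Fin (suc r) → ℕ
    exponent Fin.zero    = J
    exponent (Fin.suc i) = n ∸ c i
    exponent-term : ∀ i → cf (exponent i) ≢ 0
    exponent-term Fin.zero    = proj₂ (proj₂ high)
    exponent-term (Fin.suc i) = value-term i
    J≢n∸c : ∀ i → J ≢ n ∸ c i
    J≢n∸c i J≡ = ℕP.<-irrefl refl (ℕP.<-≤-trans (proj₁ (proj₂ high)) (ℕP.≤-trans (ℕP.≤-reflexive J≡) (ℕP.m∸n≤m n (c i))))
    exponent-inj : Injective _≡_ _≡_ exponent
    exponent-inj {Fin.zero}  {Fin.zero}  _ = refl
    exponent-inj {Fin.zero}  {Fin.suc j} e = ⊥-elim (J≢n∸c j e)
    exponent-inj {Fin.suc i} {Fin.zero}  e = ⊥-elim (J≢n∸c i (sym e))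
    exponent-inj {Fin.suc i} {Fin.suc j} e = cong Fin.suc (c-inj (ℕP.∸-cancelˡ-≡ (c≤n i) (c≤n j) e))
    many-terms : suc r ≤ #terms G conn?
    many-terms = injection-length exponent _ exponent-inj
      (λ i → ∈-filter⁺ (λ j → ¬? (cf j ℕ.≟ 0)) (term∈exps (exponent i) (exponent-term i)) (exponent-term i))

  -- (v) A(Γ;x) is even or odd iff all its terms have one sign (-1)^j, iff
  -- all (-1)^{deg v} agree, iff the degrees have a common parity.
  parity : (EvenPoly cf ⊎ OddPoly cf) ⇔ (((v : Fin n) → 2 ∣ deg G v) ⊎ ((v : Fin n) → ¬ (2 ∣ deg G v)))
  parity = ⇔-sym (uniform-parity (deg G)) ⇔-∘ (signs ⇔-∘ even-or-odd⇔signed cf)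
    where
    signs : (Σ ℤ λ s → IsSign s × SignedBy cf s) ⇔ (Σ ℤ λ t → IsSign t × (∀ v → negOnePow (deg G v) ≡ t))
    signs = mk⇔
      (λ (s , ±s , signed) → s ℤ.* negOnePow n , sign-* ±s (negOnePow-sign n) , λ v →
        let d = deg G v in
        trans (sign-solve (negOnePow d) (negOnePow n) (negOnePow-sign (n ∸ d))
                (trans (cong negOnePow (sym (ℕP.m∸n+n≡m (ℕP.<⇒≤ (deg<n v))))) (negOnePow-+ (n ∸ d) d)))
              (cong (ℤ._* negOnePow n) (signed (n ∸ d) (singleton-term v))))
      (λ (t , ±t , uniform) → t ℤ.* negOnePow n , sign-* ±t (negOnePow-sign n) , λ j cf≢0 →
        let (v , sign≡) = term-sign j (term⇒witness j cf≢0) in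
        trans sign≡ (cong (ℤ._* negOnePow n) (uniform v)))

proposition2p3 : (n : ℕ) → 0 < n → (G : Graph n) → (conn? : (S : Subset n) → Dec (Connected G S)) →
    ((R : OrderedCommutativeRing 0ℓ 0ℓ 0ℓ) → (x : OrderedCommutativeRing.Carrier R) →
    OrderedCommutativeRing._≈_ R (OrderedCommutativeRing.evalPoly R (coeff G conn?) (exps G conn?) x) (OrderedCommutativeRing.0# R) →
    ¬ (OrderedCommutativeRing._<_ R (OrderedCommutativeRing.0# R) x))
    × (δ₁ G < n × ((j : ℕ) → j < n ∸ δ₁ G → coeff G conn? j ≡ 0) × coeff G conn? (n ∸ δ₁ G) ≢ 0)
    × ((k : ℤ) → k ∈ₗ 𝒦 G → sumFrom G conn? k ≡ #ConnDefAlliances G conn? k)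
    × (HasEdge G → (r : ℕ) → (c : Fin r → ℕ) → Injective _≡_ _≡_ c →
    ((i : Fin r) → Σ (Fin n) (λ v → deg G v ≡ c i)) →
    ((v : Fin n) → Σ (Fin r) (λ i → deg G v ≡ c i)) →
    (suc r ≤ #terms G conn?)
    × ((i : Fin r) → coeff G conn? (n ∸ c i) ≢ 0)
    × coeff G conn? (n + δₙ G) ≢ 0)
    × ((EvenPoly (coeff G conn?) ⊎ OddPoly (coeff G conn?)) ⇔
    (((v : Fin n) → 2 ∣ deg G v) ⊎ ((v : Fin n) → ¬ (2 ∣ deg G v))))
proposition2p3 n 0<n G conn? =
  nonpositive-zeros , zero-multiplicity , alliances-above , degree-terms , parity
  where open AlliancePolynomial 0<n G conn?
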